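{- Let $q$ be a prime power and let $n,d$ be positive integers. Then $$k(n,\overline{d})\ \ge\ n-\left\lceil \log_{q}\!\left[2+\binom{n-1}{d-1}(q-1)^{d-1}\right]\right\rceil.$$
   Context: Let $V_n=\mathbb{F}_q^n$. The Hamming weight of $\mathbf{x}\in V_n$ is the number of nonzero coordinates of $\mathbf{x}$. A $q$-ary $[n,k,\overline{d}]_q$ linear forbidden distance code is a $k$-dimensional $\mathbb{F}_q$-linear subspace $C\subseteq V_n$ such that no nonzero codeword of $C$ has Hamming weight exactly $d$. $k(n,\overline{d})$ denotes the maximum dimension $k$ of such a code (for fixed $q$). -}

module Defs where

open import Level using (0ℓ)
open import Data.Nat as ℕ using (ℕ; zero; suc; _^_; _≤_)
open import Data.Fin using (Fin; zero; suc)
open import Data.Bool using (Bool; true; false; if_then_else_)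
open import Data.Product using (∃; _×_; _,_)
open import Relation.Nullary using (¬_; yes; no)
open import Relation.Binary.Definitions using (Decidable)
open import Relation.Binary.PropositionalEquality using (_≡_)
open import Algebra.Bundles using (CommutativeRing)

-- A finite field with exactly q elements (q is then necessarily a prime power,
-- and conversely every prime power q admits such a field, namely F_q).
record FiniteField (q : ℕ) : Set₁ where
  field
    ring : CommutativeRing 0ℓ 0ℓ
  open CommutativeRing ring using (Carrier; _≈_; _*_; 0#; 1#)
  field
    0≉1     : ¬ (0# ≈ 1#)
    inverse : ∀ x → ¬ (x ≈ 0#) → ∃ λ y → (x * y) ≈ 1#
    _≟F_    : Decidable _≈_
    enum      : Fin q → Carrier
    enum-inj  : ∀ i j → enum i ≈ enum j → i ≡ j
    enum-surj : ∀ x → ∃ λ i → enum i ≈ x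

count : ∀ {n} → (Fin n → Bool) → ℕ
count {zero}  f = 0
count {suc n} f = (if f zero then 1 else 0) ℕ.+ count (λ i → f (suc i))

module _ {q : ℕ} (F : FiniteField q) where
  open FiniteField F using (ring; _≟F_)
  open CommutativeRing ring using (Carrier; _≈_; _+_; _*_; 0#)

  ∑ : ∀ {k} → (Fin k → Carrier) → Carrier
  ∑ {zero}  v = 0#
  ∑ {suc k} v = v zero + ∑ (λ i → v (suc i))

  isNonzero : Carrier → Bool
  isNonzero x with x ≟F 0#
  ... | yes _ = false
  ... | no  _ = true

  weight : ∀ {n} → (Fin n → Carrier) → ℕ
  weight x = count (λ j → isNonzero (x j))

  IsZeroVec : ∀ {n} → (Fin n → Carrier) → Set
  IsZeroVec x = ∀ j → x j ≈ 0#

  encode : ∀ {k n} → (Fin k → Fin n → Carrier) → (Fin k → Carrier) → Fin n → Carrier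
  encode G u j = ∑ (λ i → u i * G i j)

  -- A k-dimensional linear code C ⊆ F^n, given as the row space of a k×n
  -- generator matrix G with linearly independent rows, such that no nonzero
  -- codeword has Hamming weight exactly d.
  IsForbiddenDistanceCode : (n k d : ℕ) → (Fin k → Fin n → Carrier) → Set
  IsForbiddenDistanceCode n k d G =
    (∀ u → IsZeroVec (encode G u) → IsZeroVec u)
    × (∀ u → ¬ IsZeroVec (encode G u) → ¬ (weight (encode G u) ≡ d))

  -- k(n, d̄) ≥ m : there is an [n, k, d̄]_q linear forbidden distance code with k ≥ m
  kForbidden≥ : (n d m : ℕ) → Set
  kForbidden≥ n d m = ∃ λ k → m ≤ k × ∃ λ (G : Fin k → Fin n → Carrier) → IsForbiddenDistanceCode n k d G

IsCeilLog : (q x t : ℕ) → Set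
IsCeilLog q x t = x ≤ q ^ t × (∀ s → x ≤ q ^ s → t ≤ s)

-- Greedy construction in the style of Varshamov: a generator matrix G (k × m) of a code
-- without weight-d words extends to [[1, b], [0, G]] with the same property as soon as no
-- word c b + u G with c ≠ 0 has weight d − 1, i.e. as soon as b avoids every v − u G with
-- wt v = d − 1.  There are at most q^k · C(m, d−1) (q−1)^(d−1) such words, so a suitable b
-- exists while this is below q^m; adding coordinates one by one from the empty code of
-- length t reaches length n with dimension n − t.
module Submission where

open import Defs
open import Data.Nat as ℕ using (ℕ; zero; suc; _+_; _*_; _∸_; _^_; _≤_; _<_; z≤n; s≤s; NonZero)
import Data.Nat.Properties as ℕ
open import Data.Nat.Combinatorics using (_C_; nCk+nC[k+1]≡[n+1]C[k+1])
open import Data.Nat.Solver using (module +-*-Solver)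
open import Data.Fin
  using (Fin; zero; suc; splitAt; _↑ˡ_; _↑ʳ_; combine; quotient; remainder; punchIn; punchOut; funToFin; finToFun)
open import Data.Fin.Properties
  using (_≟_; splitAt-↑ˡ; splitAt-↑ʳ; remQuot-combine; punchIn-punchOut; pigeonhole; any?; all?; ¬∀⟶∃¬;
         <-irrefl; finToFun-funToFin; funToFin-finToFin; nonZeroIndex)
open import Data.Bool using (Bool; true; false; if_then_else_)
open import Data.Product using (∃; Σ; _,_; proj₁; proj₂)
open import Data.Sum using ([_,_])
open import Relation.Nullary using (¬_; yes; no; contradiction)
open import Relation.Binary.PropositionalEquality using (_≡_; _≢_; _≗_; refl; sym; trans; cong; cong₂; subst)
open import Algebra.Bundles using (CommutativeRing)
open import Function using (_∘_)

<⇒notSurjective : ∀ {a b} → a < b → (f : Fin a → Fin b) → ∃ λ p → ∀ z → f z ≢ p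
<⇒notSurjective {b = b} a<b f with all? (λ p → any? (λ z → f z ≟ p))
-- Choosing a preimage of every point would give an injection Fin b → Fin a.
... | yes surj with i , j , i<j , gi≡gj ← pigeonhole a<b (proj₁ ∘ surj) =
  contradiction i<j (<-irrefl (trans (sym (proj₂ (surj i))) (trans (cong f gi≡gj) (proj₂ (surj j)))))
... | no ¬surj with p , p∉ ← ¬∀⟶∃¬ b _ (λ p → any? (λ z → f z ≟ p)) ¬surj =
  p , λ z fz≡p → p∉ (z , fz≡p)

funToFin-cong : ∀ {m n} {f g : Fin m → Fin n} → f ≗ g → funToFin f ≡ funToFin g
funToFin-cong {zero}  f≗g = refl
funToFin-cong {suc m} f≗g = cong₂ combine (f≗g zero) (funToFin-cong (f≗g ∘ suc))

count-cong : ∀ {n} {f g : Fin n → Bool} → f ≗ g → count f ≡ count g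
count-cong {zero}  f≗g = refl
count-cong {suc n} f≗g = cong₂ (λ b c → (if b then 1 else 0) + c) (f≗g zero) (count-cong (f≗g ∘ suc))

*-^-< : ∀ q k {a r} .{{_ : NonZero q}} → a < q ^ r → q ^ k * a < q ^ (k + r)
*-^-< q k {a} {r} a<qʳ =
  subst (q ^ k * a <_) (sym (ℕ.^-distribˡ-+-* q k r)) (ℕ.*-monoʳ-< (q ^ k) {{ℕ.m^n≢0 q k}} a<qʳ)

avoid : ∀ {q} → Fin q → Fin (q ∸ 1) → Fin q
avoid {suc q} = punchIn

avoid-surjective : ∀ {q} {i j : Fin q} → i ≢ j → ∃ λ c → avoid i c ≡ j
avoid-surjective {suc q} i≢j = punchOut i≢j , punchIn-punchOut i≢j

sphereSize : (q m w : ℕ) → ℕ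
sphereSize q zero    zero    = 1
sphereSize q zero    (suc w) = 0
sphereSize q (suc m) zero    = sphereSize q m zero
sphereSize q (suc m) (suc w) = sphereSize q m (suc w) + (q ∸ 1) * sphereSize q m w

sphereSize≡ : ∀ q m w → sphereSize q m w ≡ (m C w) * (q ∸ 1) ^ w
sphereSize≡ q zero    zero    = refl
sphereSize≡ q zero    (suc w) = refl
sphereSize≡ q (suc m) zero    = sphereSize≡ q m zero
sphereSize≡ q (suc m) (suc w)
  rewrite sphereSize≡ q m (suc w) | sphereSize≡ q m w | sym (nCk+nC[k+1]≡[n+1]C[k+1] m w) =
  pascal (m C w) (m C suc w) (q ∸ 1) ((q ∸ 1) ^ w)
  where
  open +-*-Solver
  pascal : ∀ a b c x → b * (c * x) + c * (a * x) ≡ (a + b) * (c * x)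
  pascal = solve 4 (λ a b c x → b :* (c :* x) :+ c :* (a :* x) := (a :+ b) :* (c :* x)) refl

sphereSize-≤-suc : ∀ q m w → sphereSize q m w ≤ sphereSize q (suc m) w
sphereSize-≤-suc q m zero    = ℕ.≤-refl
sphereSize-≤-suc q m (suc w) = ℕ.m≤m+n _ _

module _ {q : ℕ} (F : FiniteField q) where
  open FiniteField F
  open CommutativeRing ring
    using (Carrier; _≈_; 0#; 1#; setoid; zeroˡ; zeroʳ; *-identityˡ; *-identityʳ; +-identityˡ; +-identityʳ;
           +-assoc; *-assoc; *-comm; +-cong; *-cong; -‿cong; -‿inverseʳ; distribˡ)
    renaming (_+_ to _⊕_; _*_ to _⊛_; -_ to ⊝_;
              refl to ≈-refl; sym to ≈-sym; trans to ≈-trans; reflexive to ≈-reflexive)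
  open import Relation.Binary.Reasoning.Setoid setoid

  Word : ℕ → Set
  Word m = Fin m → Carrier

  infix 4 _≋_
  _≋_ : ∀ {m} → Word m → Word m → Set
  x ≋ y = ∀ j → x j ≈ y j

  cons : ∀ {m} → Carrier → Word m → Word (suc m)
  cons a x zero    = a
  cons a x (suc j) = x j

  cons-≋ : ∀ {m a} {y : Word m} {x : Word (suc m)} → a ≈ x zero → y ≋ x ∘ suc → cons a y ≋ x
  cons-≋ a≈ y≋ zero    = a≈
  cons-≋ a≈ y≋ (suc j) = y≋ j

  index : Carrier → Fin q
  index x = proj₁ (enum-surj x)

  enum-index : ∀ x → enum (index x) ≈ x
  enum-index x = proj₂ (enum-surj x)

  index-cong : ∀ {x y} → x ≈ y → index x ≡ index y
  index-cong {x} {y} x≈y =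
    enum-inj _ _ (≈-trans (enum-index x) (≈-trans x≈y (≈-sym (enum-index y))))

  index-injective : ∀ {x y} → index x ≡ index y → x ≈ y
  index-injective {x} {y} eq =
    ≈-trans (≈-sym (enum-index x)) (≈-trans (≈-reflexive (cong enum eq)) (enum-index y))

  index-enum : ∀ i → index (enum i) ≡ i
  index-enum i = enum-inj _ _ (enum-index (enum i))

  instance
    q≢0 : NonZero q
    q≢0 = nonZeroIndex (index 0#)

  nonzeroElem : Fin (q ∸ 1) → Carrier
  nonzeroElem c = enum (avoid (index 0#) c)

  nonzeroElem-surjective : ∀ x → ¬ x ≈ 0# → ∃ λ c → nonzeroElem c ≈ x
  nonzeroElem-surjective x x≉0 with c , c↦x ← avoid-surjective (x≉0 ∘ ≈-sym ∘ index-injective) =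
    c , subst (λ i → enum i ≈ x) (sym c↦x) (enum-index x)

  wordIndex : ∀ {m} → Word m → Fin (q ^ m)
  wordIndex x = funToFin (index ∘ x)

  wordAt : ∀ {m} → Fin (q ^ m) → Word m
  wordAt p = enum ∘ finToFun p

  wordAt-wordIndex : ∀ {m} (x : Word m) → wordAt (wordIndex x) ≋ x
  wordAt-wordIndex x j =
    ≈-trans (≈-reflexive (cong enum (finToFun-funToFin (index ∘ x) j))) (enum-index (x j))

  wordIndex-wordAt : ∀ {m} (p : Fin (q ^ m)) → wordIndex (wordAt {m} p) ≡ p
  wordIndex-wordAt {m} p =
    trans (funToFin-cong (index-enum ∘ finToFun {q} {m} p)) (funToFin-finToFin {m} p)

  wordIndex-cong : ∀ {m} {x y : Word m} → x ≋ y → wordIndex x ≡ wordIndex y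
  wordIndex-cong x≋y = funToFin-cong (index-cong ∘ x≋y)

  <⇒uncoveredWord : ∀ {a m} → a < q ^ m → (f : Fin a → Word m) → ∃ λ b → ∀ z → ¬ f z ≋ b
  <⇒uncoveredWord {m = m} a<qᵐ f with p , p∉ ← <⇒notSurjective a<qᵐ (wordIndex ∘ f) =
    wordAt p , λ z fz≋b → p∉ z (trans (wordIndex-cong fz≋b) (wordIndex-wordAt {m} p))

  isNonzero-≈0 : ∀ {x} → x ≈ 0# → isNonzero F x ≡ false
  isNonzero-≈0 {x} x≈0 with x ≟F 0#
  ... | yes _   = refl
  ... | no x≉0 = contradiction x≈0 x≉0

  isNonzero-≉0 : ∀ {x} → ¬ x ≈ 0# → isNonzero F x ≡ true
  isNonzero-≉0 {x} x≉0 with x ≟F 0#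
  ... | yes x≈0 = contradiction x≈0 x≉0
  ... | no _    = refl

  weight-head-≈0 : ∀ {m} (x : Word (suc m)) → x zero ≈ 0# → weight F x ≡ weight F (x ∘ suc)
  weight-head-≈0 x x₀≈0 = cong (λ b → (if b then 1 else 0) + weight F (x ∘ suc)) (isNonzero-≈0 x₀≈0)

  weight-head-≉0 : ∀ {m} (x : Word (suc m)) → ¬ x zero ≈ 0# → weight F x ≡ suc (weight F (x ∘ suc))
  weight-head-≉0 x x₀≉0 = cong (λ b → (if b then 1 else 0) + weight F (x ∘ suc)) (isNonzero-≉0 x₀≉0)

  isNonzero-cong : ∀ {x y} → x ≈ y → isNonzero F x ≡ isNonzero F y
  isNonzero-cong {x} {y} x≈y with x ≟F 0#
  ... | yes x≈0 = sym (isNonzero-≈0 (≈-trans (≈-sym x≈y) x≈0))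
  ... | no x≉0  = sym (isNonzero-≉0 (x≉0 ∘ ≈-trans x≈y))

  weight-cong : ∀ {m} {x y : Word m} → x ≋ y → weight F x ≡ weight F y
  weight-cong x≋y = count-cong (isNonzero-cong ∘ x≋y)

  unit-cancel : ∀ {s x} → ¬ s ≈ 0# → s ⊛ x ≈ 0# → x ≈ 0#
  unit-cancel {s} {x} s≉0 sx≈0 with s⁻¹ , ss⁻¹≈1 ← inverse s s≉0 = begin
    x               ≈⟨ ≈-sym (*-identityˡ x) ⟩
    1# ⊛ x          ≈⟨ *-cong (≈-sym ss⁻¹≈1) ≈-refl ⟩
    (s ⊛ s⁻¹) ⊛ x   ≈⟨ *-cong (*-comm s s⁻¹) ≈-refl ⟩
    (s⁻¹ ⊛ s) ⊛ x   ≈⟨ *-assoc s⁻¹ s x ⟩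
    s⁻¹ ⊛ (s ⊛ x)   ≈⟨ *-cong ≈-refl sx≈0 ⟩
    s⁻¹ ⊛ 0#        ≈⟨ zeroʳ s⁻¹ ⟩
    0#              ∎

  isNonzero-scale : ∀ {s} → ¬ s ≈ 0# → ∀ x → isNonzero F (s ⊛ x) ≡ isNonzero F x
  isNonzero-scale {s} s≉0 x with x ≟F 0#
  ... | yes x≈0 = isNonzero-≈0 (≈-trans (*-cong ≈-refl x≈0) (zeroʳ s))
  ... | no x≉0  = isNonzero-≉0 (x≉0 ∘ unit-cancel s≉0)

  weight-scale : ∀ {m s} → ¬ s ≈ 0# → (x : Word m) → weight F (λ j → s ⊛ x j) ≡ weight F x
  weight-scale s≉0 x = count-cong (isNonzero-scale s≉0 ∘ x)

  sphere : ∀ m w → Fin (sphereSize q m w) → Word m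
  sphere zero    zero    _ = λ ()
  sphere (suc m) zero    l = cons 0# (sphere m zero l)
  sphere (suc m) (suc w) l =
    [ (λ l₀ → cons 0# (sphere m (suc w) l₀))
    , (λ l₁ → cons (nonzeroElem (quotient (sphereSize q m w) l₁))
                   (sphere m w (remainder {q ∸ 1} (sphereSize q m w) l₁)))
    ] (splitAt (sphereSize q m (suc w)) l)

  sphere-↑ˡ : ∀ m w l → sphere (suc m) (suc w) (l ↑ˡ _) ≗ cons 0# (sphere m (suc w) l)
  sphere-↑ˡ m w l rewrite splitAt-↑ˡ (sphereSize q m (suc w)) l ((q ∸ 1) * sphereSize q m w) = λ _ → refl

  sphere-↑ʳ : ∀ m w c l →
    sphere (suc m) (suc w) (sphereSize q m (suc w) ↑ʳ combine c l) ≗ cons (nonzeroElem c) (sphere m w l)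
  sphere-↑ʳ m w c l
    rewrite splitAt-↑ʳ (sphereSize q m (suc w)) ((q ∸ 1) * sphereSize q m w) (combine c l) = λ j →
    cong (λ (c′ , l′) → cons (nonzeroElem c′) (sphere m w l′) j) (remQuot-combine {q ∸ 1} {sphereSize q m w} c l)

  -- Matching on x zero ≟F 0# also evaluates the head term of weight F x in ∣x∣≡w.
  sphere-surjective : ∀ m w (x : Word m) → weight F x ≡ w → ∃ λ l → sphere m w l ≋ x
  sphere-surjective zero    zero    x _ = zero , λ ()
  sphere-surjective (suc m) w       x ∣x∣≡w with x zero ≟F 0#
  sphere-surjective (suc m) zero    x ∣x∣≡w | yes x₀≈0
    with l , l↦x ← sphere-surjective m zero (x ∘ suc) ∣x∣≡w =
    l , cons-≋ (≈-sym x₀≈0) l↦x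
  sphere-surjective (suc m) (suc w) x ∣x∣≡w | yes x₀≈0
    with l , l↦x ← sphere-surjective m (suc w) (x ∘ suc) ∣x∣≡w =
    l ↑ˡ _ , λ j → ≈-trans (≈-reflexive (sphere-↑ˡ m w l j)) (cons-≋ {x = x} (≈-sym x₀≈0) l↦x j)
  sphere-surjective (suc m) (suc w) x refl | no x₀≉0
    with l , l↦x ← sphere-surjective m _ (x ∘ suc) refl | c , c↦x₀ ← nonzeroElem-surjective (x zero) x₀≉0 =
    _ ↑ʳ combine c l , λ j → ≈-trans (≈-reflexive (sphere-↑ʳ m w c l j)) (cons-≋ {x = x} c↦x₀ l↦x j)

  ∑-cong : ∀ {k} {v w : Fin k → Carrier} → v ≋ w → ∑ F v ≈ ∑ F w
  ∑-cong {zero}  v≋w = ≈-refl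
  ∑-cong {suc k} v≋w = +-cong (v≋w zero) (∑-cong (v≋w ∘ suc))

  ∑-zero : ∀ {k} {v : Fin k → Carrier} → v ≋ (λ _ → 0#) → ∑ F v ≈ 0#
  ∑-zero {zero}  v≈0 = ≈-refl
  ∑-zero {suc k} v≈0 = ≈-trans (+-cong (v≈0 zero) (∑-zero (v≈0 ∘ suc))) (+-identityˡ 0#)

  ∑-*ˡ : ∀ {k} s (v : Fin k → Carrier) → ∑ F (λ i → s ⊛ v i) ≈ s ⊛ ∑ F v
  ∑-*ˡ {zero}  s v = ≈-sym (zeroʳ s)
  ∑-*ˡ {suc k} s v = ≈-trans (+-cong ≈-refl (∑-*ˡ s (v ∘ suc))) (≈-sym (distribˡ s _ _))

  encode-cong : ∀ {k m} (G : Fin k → Fin m → Carrier) {u u′ : Word k} →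
    u ≋ u′ → encode F G u ≋ encode F G u′
  encode-cong G u≋u′ j = ∑-cong (λ i → *-cong (u≋u′ i) ≈-refl)

  encode-*ˡ : ∀ {k m} (G : Fin k → Fin m → Carrier) s u →
    encode F G (λ i → s ⊛ u i) ≋ (λ j → s ⊛ encode F G u j)
  encode-*ˡ G s u j = ≈-trans (∑-cong (λ i → *-assoc s (u i) (G i j))) (∑-*ˡ s (λ i → u i ⊛ G i j))

  inverse-≉0 : ∀ {c s} → c ⊛ s ≈ 1# → ¬ s ≈ 0#
  inverse-≉0 {c} cs≈1 s≈0 = 0≉1 (≈-trans (≈-sym (≈-trans (*-cong ≈-refl s≈0) (zeroʳ c))) cs≈1)

  inverse-cancel-affine : ∀ {c s} → c ⊛ s ≈ 1# → ∀ x y → s ⊛ (c ⊛ x ⊕ y) ⊕ ⊝ (s ⊛ y) ≈ x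
  inverse-cancel-affine {c} {s} cs≈1 x y = begin
    s ⊛ (c ⊛ x ⊕ y) ⊕ ⊝ (s ⊛ y)         ≈⟨ +-cong (distribˡ s _ _) ≈-refl ⟩
    (s ⊛ (c ⊛ x) ⊕ s ⊛ y) ⊕ ⊝ (s ⊛ y)   ≈⟨ +-assoc _ _ _ ⟩
    s ⊛ (c ⊛ x) ⊕ (s ⊛ y ⊕ ⊝ (s ⊛ y))   ≈⟨ +-cong ≈-refl (-‿inverseʳ _) ⟩
    s ⊛ (c ⊛ x) ⊕ 0#                     ≈⟨ +-identityʳ _ ⟩
    s ⊛ (c ⊛ x)                          ≈⟨ ≈-sym (*-assoc s c x) ⟩
    (s ⊛ c) ⊛ x                          ≈⟨ *-cong (≈-trans (*-comm s c) cs≈1) ≈-refl ⟩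
    1# ⊛ x                               ≈⟨ *-identityˡ x ⟩
    x                                    ∎

  extend : ∀ {k m} → (Fin k → Fin m → Carrier) → Word m → Fin (suc k) → Fin (suc m) → Carrier
  extend G b zero    zero    = 1#
  extend G b zero    (suc j) = b j
  extend G b (suc i) zero    = 0#
  extend G b (suc i) (suc j) = G i j

  encode-extend-head : ∀ {k m} (G : Fin k → Fin m → Carrier) b u → encode F (extend G b) u zero ≈ u zero
  encode-extend-head G b u =
    ≈-trans (+-cong (*-identityʳ (u zero)) (∑-zero (λ i → zeroʳ (u (suc i))))) (+-identityʳ (u zero))

  -- The tail of the codeword of u under extend G b is u₀ b + (u ∘ suc) G, definitionally.
  Admissible : ∀ {k m} → ℕ → (Fin k → Fin m → Carrier) → Word m → Set
  Admissible d G b = ∀ c u → ¬ c ≈ 0# → weight F (λ j → c ⊛ b j ⊕ encode F G u j) ≢ d ∸ 1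

  extend-forbidden : ∀ {k m d} {G : Fin k → Fin m → Carrier} {b} →
    IsForbiddenDistanceCode F m k d G → Admissible d G b →
    IsForbiddenDistanceCode F (suc m) (suc k) d (extend G b)
  extend-forbidden {k} {m} {d} {G} {b} (G-independent , G-forbidden) b-admissible = independent , forbidden
    where
    codeword : Word (suc k) → Word (suc m)
    codeword = encode F (extend G b)

    head≈ : ∀ u → codeword u zero ≈ u zero
    head≈ = encode-extend-head G b

    tail≈ : ∀ u → u zero ≈ 0# → codeword u ∘ suc ≋ encode F G (u ∘ suc)
    tail≈ u u₀≈0 j = ≈-trans (+-cong (≈-trans (*-cong u₀≈0 ≈-refl) (zeroˡ (b j))) ≈-refl) (+-identityˡ _)

    independent : ∀ u → IsZeroVec F (codeword u) → IsZeroVec F u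
    independent u uG≈0 zero    = ≈-trans (≈-sym (head≈ u)) (uG≈0 zero)
    independent u uG≈0 (suc i) =
      G-independent (u ∘ suc) (λ j → ≈-trans (≈-sym (tail≈ u (independent u uG≈0 zero) j)) (uG≈0 (suc j))) i

    forbidden : ∀ u → ¬ IsZeroVec F (codeword u) → weight F (codeword u) ≢ d
    forbidden u uG≉0 ∣uG∣≡d with u zero ≟F 0#
    ... | yes u₀≈0 = G-forbidden (u ∘ suc) tail≉0 (trans (sym (weight-cong (tail≈ u u₀≈0))) ∣tail∣≡d)
      where
      tail≉0 : ¬ IsZeroVec F (encode F G (u ∘ suc))
      tail≉0 tail≈0 = uG≉0 λ { zero    → ≈-trans (head≈ u) u₀≈0
                             ; (suc j) → ≈-trans (tail≈ u u₀≈0 j) (tail≈0 j) }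
      ∣tail∣≡d : weight F (codeword u ∘ suc) ≡ d
      ∣tail∣≡d = trans (sym (weight-head-≈0 (codeword u) (≈-trans (head≈ u) u₀≈0))) ∣uG∣≡d
    ... | no u₀≉0 = b-admissible (u zero) (u ∘ suc) u₀≉0 (cong (_∸ 1) 1+∣tail∣≡d)
      where
      1+∣tail∣≡d : suc (weight F (codeword u ∘ suc)) ≡ d
      1+∣tail∣≡d = trans (sym (weight-head-≉0 (codeword u) (u₀≉0 ∘ ≈-trans (≈-sym (head≈ u))))) ∣uG∣≡d

  sphereMinusCode : ∀ {k m} → (Fin k → Fin m → Carrier) → ∀ w →
    Fin (q ^ k * sphereSize q m w) → Word m
  sphereMinusCode {k} {m} G w z j =
    sphere m w (remainder {q ^ k} _ z) j ⊕ ⊝ encode F G (wordAt {k} (quotient (sphereSize q m w) z)) j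

  sphereMinusCode-covers : ∀ {k m w} (G : Fin k → Fin m → Carrier) u v → weight F v ≡ w →
    ∃ λ z → sphereMinusCode G w z ≋ (λ j → v j ⊕ ⊝ encode F G u j)
  sphereMinusCode-covers {k} {m} G u v ∣v∣≡w with l , l↦v ← sphere-surjective m _ v ∣v∣≡w =
    combine (wordIndex u) l , λ j → begin
      sphereMinusCode G _ (combine (wordIndex u) l) j
        ≡⟨ cong (λ (p , l′) → sphere m _ l′ j ⊕ ⊝ encode F G (wordAt p) j) (remQuot-combine (wordIndex u) l) ⟩
      sphere m _ l j ⊕ ⊝ encode F G (wordAt (wordIndex u)) j
        ≈⟨ +-cong (l↦v j) (-‿cong (encode-cong G (wordAt-wordIndex u) j)) ⟩
      v j ⊕ ⊝ encode F G u j ∎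

  -- Scaling by c⁻¹ turns c b + u G of weight w into b = v − (c⁻¹ u) G with v of weight w.
  uncovered⇒admissible : ∀ {k m d} (G : Fin k → Fin m → Carrier) b →
    (∀ z → ¬ sphereMinusCode G (d ∸ 1) z ≋ b) → Admissible d G b
  uncovered⇒admissible G b b-uncovered c u c≉0 ∣cb+uG∣≡w
    with s , cs≈1 ← inverse c c≉0
    with z , z↦ ← sphereMinusCode-covers G (λ i → s ⊛ u i) (λ j → s ⊛ (c ⊛ b j ⊕ encode F G u j))
                     (trans (weight-scale (inverse-≉0 cs≈1) (λ j → c ⊛ b j ⊕ encode F G u j)) ∣cb+uG∣≡w) =
    b-uncovered z λ j → begin
      sphereMinusCode G _ z j                                       ≈⟨ z↦ j ⟩
      s ⊛ (c ⊛ b j ⊕ encode F G u j) ⊕ ⊝ encode F G (λ i → s ⊛ u i) j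
                                                                    ≈⟨ +-cong ≈-refl (-‿cong (encode-*ˡ G s u j)) ⟩
      s ⊛ (c ⊛ b j ⊕ encode F G u j) ⊕ ⊝ (s ⊛ encode F G u j)    ≈⟨ inverse-cancel-affine cs≈1 (b j) _ ⟩
      b j                                                           ∎

  admissible-exists : ∀ {k m} d (G : Fin k → Fin m → Carrier) →
    q ^ k * sphereSize q m (d ∸ 1) < q ^ m → ∃ (Admissible d G)
  admissible-exists d G bound with b , b-uncovered ← <⇒uncoveredWord bound (sphereMinusCode G (d ∸ 1)) =
    b , uncovered⇒admissible {d = d} G b b-uncovered

  Code : (n k d : ℕ) → Set
  Code n k d = Σ (Fin k → Fin n → Carrier) (IsForbiddenDistanceCode F n k d)

  zeroCode : ∀ n d → Code n 0 d
  zeroCode n d = (λ ()) , (λ _ _ ()) , (λ u uG≉0 _ → uG≉0 (λ _ → ≈-refl))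

  extendCode : ∀ {m k d} → Code m k d → q ^ k * sphereSize q m (d ∸ 1) < q ^ m → Code (suc m) (suc k) d
  extendCode {d = d} (G , G-code) bound with b , b-admissible ← admissible-exists d G bound =
    extend G b , extend-forbidden G-code b-admissible

  greedyCode : ∀ {d} r k → sphereSize q (k + r) (d ∸ 1) < q ^ r → Code (suc k + r) (suc k) d
  greedyCode         r zero    bound = extendCode (zeroCode r _) (*-^-< q 0 {r = r} bound)
  greedyCode {d = d} r (suc k) bound =
    extendCode (greedyCode r k (ℕ.≤-<-trans (sphereSize-≤-suc q (k + r) (d ∸ 1)) bound))
               (*-^-< q (suc k) {r = r} bound)

  forbiddenCode≥ : ∀ n d t → sphereSize q n (d ∸ 1) < q ^ t → kForbidden≥ F (suc n) d (suc n ∸ t)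
  forbiddenCode≥ n d t bound with t ℕ.≤? n
  ... | no t≰n  = 0 , ℕ.≤-reflexive (ℕ.m≤n⇒m∸n≡0 (ℕ.≰⇒> t≰n)) , zeroCode (suc n) d
  ... | yes t≤n = suc (n ∸ t) , ℕ.≤-reflexive (ℕ.+-∸-assoc 1 t≤n) ,
    subst (λ n′ → Code (suc n′) (suc (n ∸ t)) d) n∸t+t≡n
      (greedyCode t (n ∸ t) (subst (λ n′ → sphereSize q n′ (d ∸ 1) < q ^ t) (sym n∸t+t≡n) bound))
    where
    n∸t+t≡n : n ∸ t + t ≡ n
    n∸t+t≡n = ℕ.m∸n+n≡m t≤n

lemma3p3 : (q : ℕ) (F : FiniteField q) (n d : ℕ) → 1 ≤ n → 1 ≤ d →
    (t : ℕ) → IsCeilLog q (2 + ((n ∸ 1) C (d ∸ 1)) * (q ∸ 1) ^ (d ∸ 1)) t →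
    kForbidden≥ F n d (n ∸ t)
lemma3p3 q F (suc n) d (s≤s z≤n) _ t (2+S≤qᵗ , _) = forbiddenCode≥ F n d t (begin-strict
  sphereSize q n (d ∸ 1)                       ≡⟨ sphereSize≡ q n (d ∸ 1) ⟩
  (n C (d ∸ 1)) * (q ∸ 1) ^ (d ∸ 1)            <⟨ ℕ.m<n+m _ (s≤s z≤n) ⟩
  2 + (n C (d ∸ 1)) * (q ∸ 1) ^ (d ∸ 1)        ≤⟨ 2+S≤qᵗ ⟩
  q ^ t                                         ∎)
  where open ℕ.≤-Reasoning
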